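{- Let $k\ge4$, $V=[k]\times[k]$, and define $\phi_n(a)=\min\{a,\frac78k\}$, $\phi_t(a)=\min\{\frac38ka,\ \frac38k+a-1,\ \frac78k\}$, $g:2^V\to\mathbb{R}_{\ge0}$ by $g(S)=\phi_t(|S|)$ if $S\cap\{(\ell,\ell):\ell\in[k]\}\ne\emptyset$ and $g(S)=\phi_n(|S|)$ otherwise, and $f(S)=\sum_{i=1}^k\big(g(R_i\cap S)+g(C_i\cap S)\big)$ for $S\subseteq V$, where $R_i=\{(i,j):j\in[k]\}$ and $C_i=\{(j,i):j\in[k]\}$. Then $f$ is a row-column-type, non-negative, monotone, submodular function.
   Context: A function $f:2^V\to\mathbb{R}$ is row-column-type if there is $h:2^V\to\mathbb{R}_{\ge0}$ with $f(A)=\sum_{i=1}^k\big(h(A\cap R_i)+h(A\cap C_i)\big)$ for all $A\subseteq V$. -}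

module Defs where

open import Data.Nat as ℕ using (ℕ; zero; suc)
open import Data.Integer using (+_)
open import Data.Rational using (ℚ; _/_; 0ℚ; 1ℚ; _+_; _-_; _*_; _⊓_; _≤_)
open import Data.Fin using (Fin; _≟_)
open import Data.Bool using (Bool; true; false; _∧_; _∨_; if_then_else_)
open import Data.Product using (_×_; _,_; proj₁; proj₂; Σ)
open import Relation.Nullary.Decidable using (⌊_⌋)
open import Relation.Binary.PropositionalEquality using (_≡_)

V : ℕ → Set
V k = Fin k × Fin k

SubV : ℕ → Set
SubV k = V k → Bool

Σ[_]_ : (k : ℕ) → (Fin k → ℚ) → ℚ
Σ[ zero ] f = 0ℚ
Σ[ suc k ] f = f Data.Fin.zero + Σ[ k ] (λ i → f (Data.Fin.suc i))

Σℕ : (k : ℕ) → (Fin k → ℕ) → ℕ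
Σℕ zero f = 0
Σℕ (suc k) f = f Data.Fin.zero ℕ.+ Σℕ k (λ i → f (Data.Fin.suc i))

card : ∀ {k} → SubV k → ℕ
card {k} S = Σℕ k (λ i → Σℕ k (λ j → if S (i , j) then 1 else 0))

ℕ→ℚ : ℕ → ℚ
ℕ→ℚ n = + n / 1

_∩_ : ∀ {k} → SubV k → SubV k → SubV k
(A ∩ B) p = A p ∧ B p

_∪_ : ∀ {k} → SubV k → SubV k → SubV k
(A ∪ B) p = A p ∨ B p

_⊆_ : ∀ {k} → SubV k → SubV k → Set
A ⊆ B = ∀ p → A p ≡ true → B p ≡ true

R : ∀ {k} → Fin k → SubV k
R i (a , b) = ⌊ a ≟ i ⌋

C : ∀ {k} → Fin k → SubV k
C i (a , b) = ⌊ b ≟ i ⌋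

anyFin : (k : ℕ) → (Fin k → Bool) → Bool
anyFin zero f = false
anyFin (suc k) f = f Data.Fin.zero ∨ anyFin k (λ i → f (Data.Fin.suc i))

meetsDiag : ∀ {k} → SubV k → Bool
meetsDiag {k} S = anyFin k (λ ℓ → S (ℓ , ℓ))

φn : ℕ → ℚ → ℚ
φn k a = a ⊓ (+ (7 ℕ.* k) / 8)

φt : ℕ → ℚ → ℚ
φt k a = (((+ (3 ℕ.* k) / 8) * a) ⊓ (((+ (3 ℕ.* k) / 8) + a) - 1ℚ)) ⊓ (+ (7 ℕ.* k) / 8)

g : ∀ k → SubV k → ℚ
g k S = if meetsDiag S then φt k (ℕ→ℚ (card S)) else φn k (ℕ→ℚ (card S))

f : ∀ k → SubV k → ℚ
f k S = Σ[ k ] (λ i → g k (R i ∩ S) + g k (C i ∩ S))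

RowColumnType : ∀ k → (SubV k → ℚ) → Set
RowColumnType k F =
  Σ (SubV k → ℚ) λ h → (∀ A → 0ℚ ≤ h A) ×
     (∀ A → F A ≡ Σ[ k ] (λ i → h (A ∩ R i) + h (A ∩ C i)))

NonNegative : ∀ k → (SubV k → ℚ) → Set
NonNegative k F = ∀ A → 0ℚ ≤ F A

Monotone : ∀ k → (SubV k → ℚ) → Set
Monotone k F = ∀ A B → A ⊆ B → F A ≤ F B

Submodular : ∀ k → (SubV k → ℚ) → Set
Submodular k F = ∀ A B → F (A ∪ B) + F (A ∩ B) ≤ F A + F B

-- Scaling by 8 makes g integral: 8 g(S) = min(8|S| + (3k − 8)·[S meets the diagonal], 7k), because a set
-- meeting the diagonal is nonempty and for |S| ≥ 1 the first term of φt is never the minimum once 3k ≥ 8.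
-- Both |S| and the indicator of meeting the diagonal are monotone and submodular, and these properties
-- survive nonnegative linear combinations, truncation at a constant (this needs monotonicity), restriction
-- to a row or column, and summation; dividing by 8 transfers them to f. Since intersection is commutative,
-- g itself witnesses that f is of row-column type.
module Submission where

open import Algebra using (CommutativeMonoid)
open import Data.Bool using (Bool; true; false; _∧_; _∨_; if_then_else_)
open import Data.Bool.Properties
  using (∧-conicalˡ; ∧-conicalʳ; ∧-comm; ∧-distribˡ-∨; ∨-zeroʳ; ∨-commutativeMonoid; ∧-idempotentCommutativeMonoid)
open import Data.Fin using (Fin; zero; suc)
open import Data.Integer as ℤ using (+_)
import Data.Integer.Properties as ℤₚ
import Data.Integer.Tactic.RingSolver as ℤ-Solver
open import Data.Nat using (ℕ; zero; suc; _+_; _*_; _∸_; _⊓_; _≤_; z≤n; s≤s; _≤?_)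
open import Data.Nat.Properties
open import Data.Nat.Tactic.RingSolver using (solve-∀)
open import Data.Product using (_×_; _,_; ∃)
open import Data.Sum using (inj₁; inj₂)
open import Data.Rational as ℚ using (0ℚ; 1ℚ; toℚᵘ)
import Data.Rational.Properties as ℚₚ
import Data.Rational.Unnormalised as ℚᵘ
import Data.Rational.Unnormalised.Properties as ℚᵘₚ
open import Function using (_∘_)
open import Relation.Binary.PropositionalEquality
open import Relation.Nullary using (yes; no)

open import Algebra.Properties.CommutativeSemigroup +-commutativeSemigroup
  using () renaming (interchange to +-interchange)
open import Algebra.Properties.CommutativeSemigroup (CommutativeMonoid.commutativeSemigroup ∨-commutativeMonoid)
  using () renaming (interchange to ∨-interchange)
open import Algebra.Properties.IdempotentCommutativeMonoid ∧-idempotentCommutativeMonoid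
  using () renaming (∙-distrˡ-∙ to ∧-distribˡ-∧)

open import Defs

toℕ : Bool → ℕ
toℕ b = if b then 1 else 0

toℕ-mono : ∀ {a b} → (a ≡ true → b ≡ true) → toℕ a ≤ toℕ b
toℕ-mono {false} _   = z≤n
toℕ-mono {true}  a⇒b = ≤-reflexive (cong toℕ (sym (a⇒b refl)))

toℕ-∨-∧ : ∀ a b → toℕ (a ∨ b) + toℕ (a ∧ b) ≡ toℕ a + toℕ b
toℕ-∨-∧ false b = +-identityʳ (toℕ b)
toℕ-∨-∧ true  b = refl

term≤Σℕ : ∀ n (h : Fin n → ℕ) i → h i ≤ Σℕ n h
term≤Σℕ (suc n) h zero    = m≤m+n (h zero) _
term≤Σℕ (suc n) h (suc i) = ≤-trans (term≤Σℕ n (h ∘ suc) i) (m≤n+m _ (h zero))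

anyFin-cong : ∀ n {u v : Fin n → Bool} → (∀ i → u i ≡ v i) → anyFin n u ≡ anyFin n v
anyFin-cong zero    u≗v = refl
anyFin-cong (suc n) u≗v = cong₂ _∨_ (u≗v zero) (anyFin-cong n (u≗v ∘ suc))

anyFin-∨ : ∀ n (u v : Fin n → Bool) → anyFin n (λ i → u i ∨ v i) ≡ anyFin n u ∨ anyFin n v
anyFin-∨ zero    u v = refl
anyFin-∨ (suc n) u v =
  trans (cong ((u zero ∨ v zero) ∨_) (anyFin-∨ n (u ∘ suc) (v ∘ suc))) (∨-interchange (u zero) (v zero) _ _)

anyFin⇒∃ : ∀ n (u : Fin n → Bool) → anyFin n u ≡ true → ∃ λ i → u i ≡ true
anyFin⇒∃ (suc n) u any-u with u zero in u₀
... | true  = zero , u₀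
... | false with anyFin⇒∃ n (u ∘ suc) any-u
...   | i , uᵢ = suc i , uᵢ

∃⇒anyFin : ∀ n (u : Fin n → Bool) i → u i ≡ true → anyFin n u ≡ true
∃⇒anyFin (suc n) u zero    uᵢ = cong (_∨ anyFin n (u ∘ suc)) uᵢ
∃⇒anyFin (suc n) u (suc i) uᵢ = trans (cong (u zero ∨_) (∃⇒anyFin n (u ∘ suc) i uᵢ)) (∨-zeroʳ (u zero))

anyFin-mono : ∀ n {u v : Fin n → Bool} → (∀ i → u i ≡ true → v i ≡ true) → anyFin n u ≡ true → anyFin n v ≡ true
anyFin-mono n {u} {v} u⇒v any-u with anyFin⇒∃ n u any-u
... | i , uᵢ = ∃⇒anyFin n v i (u⇒v i uᵢ)

module _ {k : ℕ} where

  infix 4 _≐_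

  _≐_ : SubV k → SubV k → Set
  A ≐ B = ∀ p → A p ≡ B p

  ∩-comm : ∀ (A B : SubV k) → A ∩ B ≐ B ∩ A
  ∩-comm A B p = ∧-comm (A p) (B p)

  ∩-distribˡ-∪ : ∀ (L A B : SubV k) → L ∩ (A ∪ B) ≐ (L ∩ A) ∪ (L ∩ B)
  ∩-distribˡ-∪ L A B p = ∧-distribˡ-∨ (L p) (A p) (B p)

  ∩-distribˡ-∩ : ∀ (L A B : SubV k) → L ∩ (A ∩ B) ≐ (L ∩ A) ∩ (L ∩ B)
  ∩-distribˡ-∩ L A B p = ∧-distribˡ-∧ (L p) (A p) (B p)

  ∩-⊆ˡ : ∀ (A B : SubV k) → (A ∩ B) ⊆ A
  ∩-⊆ˡ A B p = ∧-conicalˡ (A p) (B p)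

  ∩-⊆ʳ : ∀ (A B : SubV k) → (A ∩ B) ⊆ B
  ∩-⊆ʳ A B p = ∧-conicalʳ (A p) (B p)

  ∩-monoʳ : ∀ (L : SubV k) {A B} → A ⊆ B → (L ∩ A) ⊆ (L ∩ B)
  ∩-monoʳ L {A} A⊆B p LAp =
    cong₂ _∧_ (∧-conicalˡ (L p) (A p) LAp) (A⊆B p (∧-conicalʳ (L p) (A p) LAp))

  record IsMonotoneSubmodular (F : SubV k → ℕ) : Set where
    field
      respects-≐ : ∀ {A B} → A ≐ B → F A ≡ F B
      monotone   : ∀ {A B} → A ⊆ B → F A ≤ F B
      submodular : ∀ A B → F (A ∪ B) + F (A ∩ B) ≤ F A + F B

  open IsMonotoneSubmodular

  0-isMonotoneSubmodular : IsMonotoneSubmodular (λ _ → 0)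
  0-isMonotoneSubmodular = record
    { respects-≐ = λ _ → refl
    ; monotone   = λ _ → z≤n
    ; submodular = λ _ _ → z≤n
    }

  +-isMonotoneSubmodular : ∀ {F G} → IsMonotoneSubmodular F → IsMonotoneSubmodular G →
                           IsMonotoneSubmodular (λ A → F A + G A)
  +-isMonotoneSubmodular {F} {G} F-ms G-ms = record
    { respects-≐ = λ A≐B → cong₂ _+_ (respects-≐ F-ms A≐B) (respects-≐ G-ms A≐B)
    ; monotone   = λ A⊆B → +-mono-≤ (monotone F-ms A⊆B) (monotone G-ms A⊆B)
    ; submodular = λ A B → subst₂ _≤_
        (+-interchange (F (A ∪ B)) (F (A ∩ B)) (G (A ∪ B)) (G (A ∩ B)))
        (+-interchange (F A) (F B) (G A) (G B))
        (+-mono-≤ (submodular F-ms A B) (submodular G-ms A B))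
    }

  *-isMonotoneSubmodular : ∀ c {F} → IsMonotoneSubmodular F → IsMonotoneSubmodular (λ A → c * F A)
  *-isMonotoneSubmodular c {F} F-ms = record
    { respects-≐ = cong (c *_) ∘ respects-≐ F-ms
    ; monotone   = *-monoʳ-≤ c ∘ monotone F-ms
    ; submodular = λ A B → subst₂ _≤_
        (*-distribˡ-+ c (F (A ∪ B)) (F (A ∩ B)))
        (*-distribˡ-+ c (F A) (F B))
        (*-monoʳ-≤ c (submodular F-ms A B))
    }

  Σℕ-isMonotoneSubmodular : ∀ n {F : Fin n → SubV k → ℕ} → (∀ i → IsMonotoneSubmodular (F i)) →
                            IsMonotoneSubmodular (λ A → Σℕ n (λ i → F i A))
  Σℕ-isMonotoneSubmodular zero    _    = 0-isMonotoneSubmodular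
  Σℕ-isMonotoneSubmodular (suc n) F-ms =
    +-isMonotoneSubmodular (F-ms zero) (Σℕ-isMonotoneSubmodular n (F-ms ∘ suc))

  ∩ˡ-isMonotoneSubmodular : ∀ (L : SubV k) {F} → IsMonotoneSubmodular F → IsMonotoneSubmodular (λ A → F (L ∩ A))
  ∩ˡ-isMonotoneSubmodular L {F} F-ms = record
    { respects-≐ = λ A≐B → respects-≐ F-ms (λ p → cong (L p ∧_) (A≐B p))
    ; monotone   = monotone F-ms ∘ ∩-monoʳ L
    ; submodular = λ A B → subst₂ (λ x y → x + y ≤ F (L ∩ A) + F (L ∩ B))
        (respects-≐ F-ms (λ p → sym (∩-distribˡ-∪ L A B p)))
        (respects-≐ F-ms (λ p → sym (∩-distribˡ-∩ L A B p)))
        (submodular F-ms (L ∩ A) (L ∩ B))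
    }

  truncation-submodular : ∀ K {a b c d} → a + b ≤ c + d → b ≤ c → b ≤ d →
                          a ⊓ K + b ⊓ K ≤ c ⊓ K + d ⊓ K
  truncation-submodular K {a} {b} {c} {d} ab≤cd b≤c b≤d with K ≤? c | K ≤? d
  ... | yes K≤c | _ = begin
    a ⊓ K + b ⊓ K  ≤⟨ +-mono-≤ (m⊓n≤n a K) (⊓-monoˡ-≤ K b≤d) ⟩
    K + d ⊓ K      ≡⟨ cong (_+ d ⊓ K) (m≥n⇒m⊓n≡n K≤c) ⟨
    c ⊓ K + d ⊓ K  ∎
    where open ≤-Reasoning
  ... | no _ | yes K≤d = begin
    a ⊓ K + b ⊓ K  ≤⟨ +-mono-≤ (m⊓n≤n a K) (⊓-monoˡ-≤ K b≤c) ⟩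
    K + c ⊓ K      ≡⟨ +-comm K (c ⊓ K) ⟩
    c ⊓ K + K      ≡⟨ cong (λ x → c ⊓ K + x) (m≥n⇒m⊓n≡n K≤d) ⟨
    c ⊓ K + d ⊓ K  ∎
    where open ≤-Reasoning
  ... | no K≰c | no K≰d = begin
    a ⊓ K + b ⊓ K  ≤⟨ +-mono-≤ (m⊓n≤m a K) (m⊓n≤m b K) ⟩
    a + b          ≤⟨ ab≤cd ⟩
    c + d          ≡⟨ cong₂ _+_ (m≤n⇒m⊓n≡m (<⇒≤ (≰⇒> K≰c))) (m≤n⇒m⊓n≡m (<⇒≤ (≰⇒> K≰d))) ⟨
    c ⊓ K + d ⊓ K  ∎
    where open ≤-Reasoning

  ⊓-isMonotoneSubmodular : ∀ K {F} → IsMonotoneSubmodular F → IsMonotoneSubmodular (λ A → F A ⊓ K)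
  ⊓-isMonotoneSubmodular K {F} F-ms = record
    { respects-≐ = cong (_⊓ K) ∘ respects-≐ F-ms
    ; monotone   = ⊓-monoˡ-≤ K ∘ monotone F-ms
    ; submodular = λ A B → truncation-submodular K (submodular F-ms A B)
        (monotone F-ms (∩-⊆ˡ A B)) (monotone F-ms (∩-⊆ʳ A B))
    }

  membership-isMonotoneSubmodular : ∀ (p : V k) → IsMonotoneSubmodular (λ A → toℕ (A p))
  membership-isMonotoneSubmodular p = record
    { respects-≐ = λ A≐B → cong toℕ (A≐B p)
    ; monotone   = λ A⊆B → toℕ-mono (A⊆B p)
    ; submodular = λ A B → ≤-reflexive (toℕ-∨-∧ (A p) (B p))
    }

  card-isMonotoneSubmodular : IsMonotoneSubmodular card
  card-isMonotoneSubmodular =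
    Σℕ-isMonotoneSubmodular k λ i → Σℕ-isMonotoneSubmodular k λ j → membership-isMonotoneSubmodular (i , j)

  meetsDiag-respects-≐ : ∀ {A B} → A ≐ B → meetsDiag A ≡ meetsDiag B
  meetsDiag-respects-≐ A≐B = anyFin-cong k (λ ℓ → A≐B (ℓ , ℓ))

  meetsDiag-mono : ∀ {A B} → A ⊆ B → meetsDiag A ≡ true → meetsDiag B ≡ true
  meetsDiag-mono A⊆B = anyFin-mono k (λ ℓ → A⊆B (ℓ , ℓ))

  meetsDiag-isMonotoneSubmodular : IsMonotoneSubmodular (λ A → toℕ (meetsDiag A))
  meetsDiag-isMonotoneSubmodular = record
    { respects-≐ = cong toℕ ∘ meetsDiag-respects-≐
    ; monotone   = toℕ-mono ∘ meetsDiag-mono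
    ; submodular = submodular′
    }
    where
    open ≤-Reasoning
    submodular′ : ∀ (A B : SubV k) → toℕ (meetsDiag (A ∪ B)) + toℕ (meetsDiag (A ∩ B)) ≤ toℕ (meetsDiag A) + toℕ (meetsDiag B)
    submodular′ A B = begin
      toℕ (meetsDiag (A ∪ B)) + toℕ (meetsDiag (A ∩ B))
        ≡⟨ cong (λ b → toℕ b + toℕ (meetsDiag (A ∩ B))) (anyFin-∨ k (λ ℓ → A (ℓ , ℓ)) (λ ℓ → B (ℓ , ℓ))) ⟩
      toℕ (meetsDiag A ∨ meetsDiag B) + toℕ (meetsDiag (A ∩ B))
        ≤⟨ +-monoʳ-≤ _ (toℕ-mono (λ A∩B-meets →
             cong₂ _∧_ (meetsDiag-mono (∩-⊆ˡ A B) A∩B-meets) (meetsDiag-mono (∩-⊆ʳ A B) A∩B-meets))) ⟩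
      toℕ (meetsDiag A ∨ meetsDiag B) + toℕ (meetsDiag A ∧ meetsDiag B)
        ≡⟨ toℕ-∨-∧ (meetsDiag A) (meetsDiag B) ⟩
      toℕ (meetsDiag A) + toℕ (meetsDiag B) ∎

  meetsDiag⇒1≤card : ∀ (S : SubV k) → meetsDiag S ≡ true → 1 ≤ card S
  meetsDiag⇒1≤card S S-meets with anyFin⇒∃ k (λ ℓ → S (ℓ , ℓ)) S-meets
  ... | ℓ , Sℓℓ = begin
    1                              ≡⟨ cong toℕ Sℓℓ ⟨
    toℕ (S (ℓ , ℓ))                ≤⟨ term≤Σℕ k (λ j → toℕ (S (ℓ , j))) ℓ ⟩
    Σℕ k (λ j → toℕ (S (ℓ , j)))   ≤⟨ term≤Σℕ k (λ i → Σℕ k (λ j → toℕ (S (i , j)))) ℓ ⟩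
    card S                         ∎
    where open ≤-Reasoning

open IsMonotoneSubmodular

eighths : ℕ → ℚ.ℚ
eighths n = + n ℚ./ 8

toℚᵘ-eighths : ∀ n → toℚᵘ (eighths n) ℚᵘ.≃ ℚᵘ.mkℚᵘ (+ n) 7
toℚᵘ-eighths n = ℚₚ.toℚᵘ-fromℚᵘ (ℚᵘ.mkℚᵘ (+ n) 7)

toℚᵘ-ℕ→ℚ : ∀ n → toℚᵘ (ℕ→ℚ n) ℚᵘ.≃ ℚᵘ.mkℚᵘ (+ n) 0
toℚᵘ-ℕ→ℚ n = ℚₚ.toℚᵘ-fromℚᵘ (ℚᵘ.mkℚᵘ (+ n) 0)

eighths-+ : ∀ m n → eighths m ℚ.+ eighths n ≡ eighths (m + n)
eighths-+ m n = ℚₚ.toℚᵘ-injective (begin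
  toℚᵘ (eighths m ℚ.+ eighths n)                     ≈⟨ ℚₚ.toℚᵘ-homo-+ (eighths m) (eighths n) ⟩
  toℚᵘ (eighths m) ℚᵘ.+ toℚᵘ (eighths n)             ≈⟨ ℚᵘₚ.+-cong (toℚᵘ-eighths m) (toℚᵘ-eighths n) ⟩
  ℚᵘ.mkℚᵘ (+ m) 7 ℚᵘ.+ ℚᵘ.mkℚᵘ (+ n) 7               ≈⟨ ℚᵘ.*≡* (trans (same-denominator (+ m) (+ n))
                                                           (cong (ℤ._* + 64) (sym (ℤₚ.pos-+ m n)))) ⟩
  ℚᵘ.mkℚᵘ (+ (m + n)) 7                              ≈⟨ toℚᵘ-eighths (m + n) ⟨
  toℚᵘ (eighths (m + n))                             ∎)
  where
  open ℚᵘₚ.≃-Reasoning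
  same-denominator : ∀ x y → (x ℤ.* + 8 ℤ.+ y ℤ.* + 8) ℤ.* + 8 ≡ (x ℤ.+ y) ℤ.* + 64
  same-denominator = ℤ-Solver.solve-∀

eighths-* : ∀ m n → eighths m ℚ.* ℕ→ℚ n ≡ eighths (m * n)
eighths-* m n = ℚₚ.toℚᵘ-injective (begin
  toℚᵘ (eighths m ℚ.* ℕ→ℚ n)              ≈⟨ ℚₚ.toℚᵘ-homo-* (eighths m) (ℕ→ℚ n) ⟩
  toℚᵘ (eighths m) ℚᵘ.* toℚᵘ (ℕ→ℚ n)      ≈⟨ ℚᵘₚ.*-cong (toℚᵘ-eighths m) (toℚᵘ-ℕ→ℚ n) ⟩
  ℚᵘ.mkℚᵘ (+ m ℤ.* + n) 7                 ≈⟨ ℚᵘ.*≡* (cong (ℤ._* + 8) (sym (ℤₚ.pos-* m n))) ⟩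
  ℚᵘ.mkℚᵘ (+ (m * n)) 7                   ≈⟨ toℚᵘ-eighths (m * n) ⟨
  toℚᵘ (eighths (m * n))                  ∎)
  where open ℚᵘₚ.≃-Reasoning

ℕ→ℚ≡eighths : ∀ n → ℕ→ℚ n ≡ eighths (8 * n)
ℕ→ℚ≡eighths n = ℚₚ.toℚᵘ-injective (begin
  toℚᵘ (ℕ→ℚ n)            ≈⟨ toℚᵘ-ℕ→ℚ n ⟩
  ℚᵘ.mkℚᵘ (+ n) 0         ≈⟨ ℚᵘ.*≡* (trans (ℤₚ.*-comm (+ n) (+ 8))
                               (sym (trans (ℤₚ.*-identityʳ (+ (8 * n))) (ℤₚ.pos-* 8 n)))) ⟩
  ℚᵘ.mkℚᵘ (+ (8 * n)) 7   ≈⟨ toℚᵘ-eighths (8 * n) ⟨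
  toℚᵘ (eighths (8 * n))  ∎)
  where open ℚᵘₚ.≃-Reasoning

eighths[n+8]-1≡eighths[n] : ∀ n → eighths (n + 8) ℚ.- 1ℚ ≡ eighths n
eighths[n+8]-1≡eighths[n] n = begin
  eighths (n + 8) ℚ.- 1ℚ             ≡⟨ cong (ℚ._- 1ℚ) (eighths-+ n 8) ⟨
  (eighths n ℚ.+ 1ℚ) ℚ.+ ℚ.- 1ℚ      ≡⟨ ℚₚ.+-assoc (eighths n) 1ℚ (ℚ.- 1ℚ) ⟩
  eighths n ℚ.+ (1ℚ ℚ.+ ℚ.- 1ℚ)      ≡⟨ cong (eighths n ℚ.+_) (ℚₚ.+-inverseʳ 1ℚ) ⟩
  eighths n ℚ.+ 0ℚ                   ≡⟨ ℚₚ.+-identityʳ (eighths n) ⟩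
  eighths n                          ∎
  where open ≡-Reasoning

eighths-mono-≤ : ∀ {m n} → m ≤ n → eighths m ℚ.≤ eighths n
eighths-mono-≤ {m} {n} m≤n = ℚₚ.toℚᵘ-cancel-≤ (begin
  toℚᵘ (eighths m)  ≃⟨ toℚᵘ-eighths m ⟩
  ℚᵘ.mkℚᵘ (+ m) 7   ≤⟨ ℚᵘ.*≤* (ℤₚ.*-monoʳ-≤-nonNeg (+ 8) (ℤ.+≤+ m≤n)) ⟩
  ℚᵘ.mkℚᵘ (+ n) 7   ≃⟨ toℚᵘ-eighths n ⟨
  toℚᵘ (eighths n)  ∎)
  where open ℚᵘₚ.≤-Reasoning

eighths-nonNeg : ∀ n → 0ℚ ℚ.≤ eighths n
eighths-nonNeg n = eighths-mono-≤ {0} {n} z≤n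

eighths-⊓ : ∀ m n → eighths m ℚ.⊓ eighths n ≡ eighths (m ⊓ n)
eighths-⊓ m n with ≤-total m n
... | inj₁ m≤n = trans (ℚₚ.p≤q⇒p⊓q≡p (eighths-mono-≤ m≤n)) (cong eighths (sym (m≤n⇒m⊓n≡m m≤n)))
... | inj₂ n≤m = trans (ℚₚ.p≥q⇒p⊓q≡q (eighths-mono-≤ n≤m)) (cong eighths (sym (m≥n⇒m⊓n≡n n≤m)))

Σ[]-cong : ∀ n {u v : Fin n → ℚ.ℚ} → (∀ i → u i ≡ v i) → Σ[ n ] u ≡ Σ[ n ] v
Σ[]-cong zero    u≗v = refl
Σ[]-cong (suc n) u≗v = cong₂ ℚ._+_ (u≗v zero) (Σ[]-cong n (u≗v ∘ suc))

Σ[]-eighths : ∀ n (h : Fin n → ℕ) → Σ[ n ] (eighths ∘ h) ≡ eighths (Σℕ n h)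
Σ[]-eighths zero    h = refl
Σ[]-eighths (suc n) h = trans (cong (eighths (h zero) ℚ.+_) (Σ[]-eighths n (h ∘ suc))) (eighths-+ (h zero) _)

eighths-transport : ∀ {k} {F : SubV k → ℚ.ℚ} {G : SubV k → ℕ} → (∀ A → F A ≡ eighths (G A)) →
                    IsMonotoneSubmodular G → NonNegative k F × Monotone k F × Submodular k F
eighths-transport {k} {F} {G} F≡G/8 G-ms = nonNegative , monotone′ , submodular′
  where
  nonNegative : NonNegative k F
  nonNegative A = subst (0ℚ ℚ.≤_) (sym (F≡G/8 A)) (eighths-nonNeg (G A))

  monotone′ : Monotone k F
  monotone′ A B A⊆B = subst₂ ℚ._≤_ (sym (F≡G/8 A)) (sym (F≡G/8 B)) (eighths-mono-≤ (monotone G-ms A⊆B))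

  submodular′ : Submodular k F
  submodular′ A B = begin
    F (A ∪ B) ℚ.+ F (A ∩ B)                    ≡⟨ cong₂ ℚ._+_ (F≡G/8 (A ∪ B)) (F≡G/8 (A ∩ B)) ⟩
    eighths (G (A ∪ B)) ℚ.+ eighths (G (A ∩ B)) ≡⟨ eighths-+ (G (A ∪ B)) (G (A ∩ B)) ⟩
    eighths (G (A ∪ B) + G (A ∩ B))            ≤⟨ eighths-mono-≤ (submodular G-ms A B) ⟩
    eighths (G A + G B)                        ≡⟨ eighths-+ (G A) (G B) ⟨
    eighths (G A) ℚ.+ eighths (G B)            ≡⟨ cong₂ ℚ._+_ (F≡G/8 A) (F≡G/8 B) ⟨
    F A ℚ.+ F B                                ∎
    where open ℚₚ.≤-Reasoning

φn≡eighths : ∀ k c → φn k (ℕ→ℚ c) ≡ eighths (8 * c ⊓ (7 * k))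
φn≡eighths k c = trans (cong (ℚ._⊓ eighths (7 * k)) (ℕ→ℚ≡eighths c)) (eighths-⊓ (8 * c) (7 * k))

-- With t = d + 8 and c ≥ 1, the term t·c/8 of φt is never the smallest: t·c = 8c + d + d(c − 1).
φt-first-two-terms≡eighths : ∀ {d t c} → d + 8 ≡ t → 1 ≤ c →
                 (eighths t ℚ.* ℕ→ℚ c) ℚ.⊓ ((eighths t ℚ.+ ℕ→ℚ c) ℚ.- 1ℚ) ≡ eighths (8 * c + d)
φt-first-two-terms≡eighths {d} {c = suc c} refl (s≤s z≤n) = begin
  (eighths (d + 8) ℚ.* ℕ→ℚ (suc c)) ℚ.⊓ ((eighths (d + 8) ℚ.+ ℕ→ℚ (suc c)) ℚ.- 1ℚ)
    ≡⟨ cong₂ ℚ._⊓_ (eighths-* (d + 8) (suc c)) shifted ⟩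
  eighths ((d + 8) * suc c) ℚ.⊓ eighths (8 * suc c + d)
    ≡⟨ eighths-⊓ ((d + 8) * suc c) (8 * suc c + d) ⟩
  eighths ((d + 8) * suc c ⊓ (8 * suc c + d))
    ≡⟨ cong eighths (m≥n⇒m⊓n≡n (subst (8 * suc c + d ≤_) (sym (expand d c)) (m≤m+n _ (d * c)))) ⟩
  eighths (8 * suc c + d) ∎
  where
  open ≡-Reasoning
  expand : ∀ d c → (d + 8) * (1 + c) ≡ (8 * (1 + c) + d) + d * c
  expand = solve-∀
  reorder : ∀ d c → d + 8 + 8 * (1 + c) ≡ (8 * (1 + c) + d) + 8
  reorder = solve-∀
  shifted : (eighths (d + 8) ℚ.+ ℕ→ℚ (suc c)) ℚ.- 1ℚ ≡ eighths (8 * suc c + d)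
  shifted = begin
    (eighths (d + 8) ℚ.+ ℕ→ℚ (suc c)) ℚ.- 1ℚ
      ≡⟨ cong (λ x → (eighths (d + 8) ℚ.+ x) ℚ.- 1ℚ) (ℕ→ℚ≡eighths (suc c)) ⟩
    (eighths (d + 8) ℚ.+ eighths (8 * suc c)) ℚ.- 1ℚ
      ≡⟨ cong (ℚ._- 1ℚ) (eighths-+ (d + 8) (8 * suc c)) ⟩
    eighths (d + 8 + 8 * suc c) ℚ.- 1ℚ
      ≡⟨ cong (λ x → eighths x ℚ.- 1ℚ) (reorder d c) ⟩
    eighths ((8 * suc c + d) + 8) ℚ.- 1ℚ
      ≡⟨ eighths[n+8]-1≡eighths[n] (8 * suc c + d) ⟩
    eighths (8 * suc c + d) ∎

φt≡eighths : ∀ k c → 8 ≤ 3 * k → 1 ≤ c → φt k (ℕ→ℚ c) ≡ eighths ((8 * c + (3 * k ∸ 8)) ⊓ (7 * k))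
φt≡eighths k c 8≤3k 1≤c =
  trans (cong (ℚ._⊓ eighths (7 * k)) (φt-first-two-terms≡eighths (m∸n+n≡m 8≤3k) 1≤c)) (eighths-⊓ (8 * c + (3 * k ∸ 8)) (7 * k))

-- g₈ = 8 g, the case split of g becoming a bonus of 3k − 8 for meeting the diagonal.
g₈ : ∀ k → SubV k → ℕ
g₈ k S = (8 * card S + (3 * k ∸ 8) * toℕ (meetsDiag S)) ⊓ (7 * k)

f₈ : ∀ k → SubV k → ℕ
f₈ k A = Σℕ k (λ i → g₈ k (R i ∩ A) + g₈ k (C i ∩ A))

g≡eighths∘g₈ : ∀ {k} → 8 ≤ 3 * k → ∀ S → g k S ≡ eighths (g₈ k S)
g≡eighths∘g₈ {k} 8≤3k S = by-diagonal (meetsDiag S) (meetsDiag⇒1≤card S)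
  where
  c = card S
  d = 3 * k ∸ 8
  by-diagonal : ∀ b → (b ≡ true → 1 ≤ c) →
    (if b then φt k (ℕ→ℚ c) else φn k (ℕ→ℚ c)) ≡ eighths ((8 * c + d * toℕ b) ⊓ (7 * k))
  by-diagonal false _ rewrite *-zeroʳ d | +-identityʳ (8 * c) = φn≡eighths k c
  by-diagonal true 1≤c rewrite *-identityʳ d = φt≡eighths k c 8≤3k (1≤c refl)

g-respects-≐ : ∀ {k} {A B : SubV k} → A ≐ B → g k A ≡ g k B
g-respects-≐ {k} A≐B = cong₂ (λ b c → if b then φt k (ℕ→ℚ c) else φn k (ℕ→ℚ c))
  (meetsDiag-respects-≐ A≐B) (respects-≐ card-isMonotoneSubmodular A≐B)

g₈-isMonotoneSubmodular : ∀ k → IsMonotoneSubmodular (g₈ k)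
g₈-isMonotoneSubmodular k = ⊓-isMonotoneSubmodular (7 * k) (+-isMonotoneSubmodular
  (*-isMonotoneSubmodular 8 card-isMonotoneSubmodular)
  (*-isMonotoneSubmodular (3 * k ∸ 8) meetsDiag-isMonotoneSubmodular))

f₈-isMonotoneSubmodular : ∀ k → IsMonotoneSubmodular (f₈ k)
f₈-isMonotoneSubmodular k = Σℕ-isMonotoneSubmodular k λ i → +-isMonotoneSubmodular
  (∩ˡ-isMonotoneSubmodular (R i) (g₈-isMonotoneSubmodular k))
  (∩ˡ-isMonotoneSubmodular (C i) (g₈-isMonotoneSubmodular k))

f≡eighths∘f₈ : ∀ {k} → 8 ≤ 3 * k → ∀ A → f k A ≡ eighths (f₈ k A)
f≡eighths∘f₈ {k} 8≤3k A = trans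
  (Σ[]-cong k λ i → trans (cong₂ ℚ._+_ (g≡eighths∘g₈ 8≤3k (R i ∩ A)) (g≡eighths∘g₈ 8≤3k (C i ∩ A)))
                          (eighths-+ (g₈ k (R i ∩ A)) (g₈ k (C i ∩ A))))
  (Σ[]-eighths k (λ i → g₈ k (R i ∩ A) + g₈ k (C i ∩ A)))

lemma2p7 : (k : ℕ) → 4 ≤ k →
    RowColumnType k (f k) × NonNegative k (f k) × Monotone k (f k) × Submodular k (f k)
lemma2p7 k 4≤k = rowColumnType , eighths-transport (f≡eighths∘f₈ 8≤3k) (f₈-isMonotoneSubmodular k)
  where
  8≤3k : 8 ≤ 3 * k
  8≤3k = ≤-trans (m≤m+n 8 4) (*-monoʳ-≤ 3 4≤k)

  rowColumnType : RowColumnType k (f k)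
  rowColumnType =
    g k ,
    (λ A → subst (0ℚ ℚ.≤_) (sym (g≡eighths∘g₈ 8≤3k A)) (eighths-nonNeg (g₈ k A))) ,
    (λ A → Σ[]-cong k λ i → cong₂ ℚ._+_ (g-respects-≐ (∩-comm (R i) A)) (g-respects-≐ (∩-comm (C i) A)))
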